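{- Let $(f_i:\underline{X}_i\to\underline{Y}_i)_{i\in I}$ be any set-indexed family of functions between topological spaces. Then $\lceil f_i\rceil_{i\in I}$ is a least upper bound of $\{f_i\mid i\in I\}$ with respect to $\leq_2$: $f_j\leq_2\lceil f_i\rceil_{i\in I}$ for every $j\in I$, and whenever $g$ is a function between topological spaces with $f_i\leq_2 g$ for all $i\in I$, then $\lceil f_i\rceil_{i\in I}\leq_2 g$. Consequently $(\mathbb{F}_2,\leq_2)$ is a complete join-semilattice, and the supremum of a set $S$ of elements is the equivalence class of $\lceil f\rceil_{f\in S}$ (taking representatives).
   Context: A partial function $F:\subseteq X\to Y$ is a function from a subset $\operatorname{dom}(F)\subseteq X$ to $Y$; between topological spaces it is called continuous if it is continuous on $\operatorname{dom}(F)$ with the subspace topology. For (total) functions $f:\underline{X}_1\to\underline{Y}_1$ and $g:\underline{X}_2\to\underline{Y}_2$ between topological spaces, $f\leq_2 g$ means: there are continuous partial functions $F:\subseteq \underline{X}_1\times\underline{Y}_2\to\underline{Y}_1$ (product topology) and $G:\subseteq\underline{X}_1\to\underline{X}_2$ such that for all $x\in X_1$, $G(x)$ and $F(x,g(G(x)))$ are defined and $f(x)=F(x,g(G(x)))$. $\leq_2$ is a preorder; $\mathbb{F}_2$ denotes the class of its equivalence classes of functions between topological spaces, partially ordered by $\leq_2$. The coproduct $\coprod_{i\in I}\underline{X}_i$ is the set $\bigcup_{i\in I}\{i\}\times X_i$ with the smallest topology containing all sets $\{i\}\times U$, $U$ open in $\underline{X}_i$. For functions $f_i:\underline{X}_i\to\underline{Y}_i$,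 $\lceil f_i\rceil_{i\in I}:\coprod_{i\in I}\underline{X}_i\to\coprod_{i\in I}\underline{Y}_i$ is defined by $\lceil f_i\rceil_{i\in I}(i,x)=(i,f_i(x))$. A partially ordered class is a complete join-semilattice if every subset (of any cardinality) has a least upper bound. -}

module Defs where

open import Data.Unit using (⊤)
open import Data.Product using (Σ; Σ-syntax; _×_; _,_; proj₁; proj₂)
open import Function.Bundles using (_⇔_)
open import Relation.Binary.PropositionalEquality using (_≡_)

Subset : Set → Set₁
Subset X = X → Set

-- A topology on X: a collection of open subsets containing X, closed under
-- binary intersections and arbitrary (Set-indexed) unions, and closed under
-- extensional equality of subsets (predicates are proof-relevant).
record Topology (X : Set) : Set₂ where
  field
    Open      : Subset X → Set₁
    full-open : Open (λ _ → ⊤)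
    ∩-open    : ∀ {U V} → Open U → Open V → Open (λ x → U x × V x)
    ⋃-open    : (J : Set) (U : J → Subset X) → (∀ j → Open (U j)) →
                Open (λ x → Σ J λ j → U j x)
    ext-open  : ∀ {U V} → Open U → (∀ x → U x ⇔ V x) → Open V

record Space : Set₂ where
  field
    Carrier  : Set
    topology : Topology Carrier
  open Topology topology public

open Space public

data Gen {X : Set} (B : Subset X → Set₁) : Subset X → Set₁ where
  basic : ∀ {U} → B U → Gen B U
  full  : Gen B (λ _ → ⊤)
  inter : ∀ {U V} → Gen B U → Gen B V → Gen B (λ x → U x × V x)
  union : (J : Set) (U : J → Subset X) → (∀ j → Gen B (U j)) →
          Gen B (λ x → Σ J λ j → U j x)
  ext   : ∀ {U V} → Gen B U → (∀ x → U x ⇔ V x) → Gen B V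

generated : {X : Set} → (Subset X → Set₁) → Topology X
generated B = record
  { Open = Gen B ; full-open = full ; ∩-open = inter
  ; ⋃-open = union ; ext-open = ext }

_⊗_ : Space → Space → Space
A ⊗ B = record
  { Carrier  = Carrier A × Carrier B
  ; topology = generated λ W →
      Σ[ U ∈ Subset (Carrier A) ] Σ[ V ∈ Subset (Carrier B) ]
        (Open A U × Open B V × (∀ p → W p ⇔ (U (proj₁ p) × V (proj₂ p))))
  }

∐ : (I : Set) → (I → Space) → Space
∐ I X = record
  { Carrier  = Σ I (λ i → Carrier (X i))
  ; topology = generated λ W →
      Σ[ i ∈ I ] Σ[ U ∈ Subset (Carrier (X i)) ]
        (Open (X i) U
         × (∀ x → W (i , x) ⇔ U x)
         × (∀ j x → W (j , x) → j ≡ i))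
  }

-- A (total) function between topological spaces (no continuity required).
record Fun : Set₂ where
  field
    Dom : Space
    Cod : Space
    fn  : Carrier Dom → Carrier Cod

open Fun public

-- Continuous partial function A ⇀ B: a domain dom ⊆ A and a map on it
-- (dom is required to be a proposition, so it is a genuine subset and app
-- cannot depend on the membership proof), continuous w.r.t. the subspace
-- topology on dom: the preimage of every open V is the trace on dom of
-- some open U of A.
record PCont (A B : Space) : Set₂ where
  field
    dom      : Subset (Carrier A)
    dom-prop : (x : Carrier A) (d e : dom x) → d ≡ e
    app      : (x : Carrier A) → dom x → Carrier B
    cont : (V : Subset (Carrier B)) → Open B V →
           Σ[ U ∈ Subset (Carrier A) ]
             (Open A U × (∀ x (d : dom x) → V (app x d) ⇔ U x))

open PCont public

_≤₂_ : Fun → Fun → Set₂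
f ≤₂ g =
  Σ[ F ∈ PCont (Dom f ⊗ Cod g) (Cod f) ]
  Σ[ G ∈ PCont (Dom f) (Dom g) ]
    ((x : Carrier (Dom f)) →
      Σ[ dG ∈ dom G x ]
      Σ[ dF ∈ dom F (x , fn g (app G x dG)) ]
        fn f x ≡ app F (x , fn g (app G x dG)) dF)

⌈_⌉ : {I : Set} → (I → Fun) → Fun
⌈_⌉ {I} f = record
  { Dom = ∐ I (λ i → Dom (f i))
  ; Cod = ∐ I (λ i → Cod (f i))
  ; fn  = λ p → proj₁ p , fn (f (proj₁ p)) (proj₂ p)
  }

module Submission where

-- Upper bound:  f j ≤₂ ⌈ f ⌉ via G = ι j and F = π j ∘ snd.
-- Leastness:    if (F i , G i) witness f i ≤₂ g, then ⌈ f ⌉ ≤₂ g via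
--               G = [ G ] and F = [ ι i ∘ F i ] ∘ distrib.

open import Defs
open import Data.Product using (_×_; Σ; Σ-syntax; _,_; proj₁; proj₂)
open import Data.Unit using (⊤; tt)
open import Function.Bundles using (_⇔_; mk⇔; Equivalence)
open import Function.Properties.Equivalence using ()
  renaming (refl to ⇔-refl; sym to ⇔-sym; trans to ⇔-trans)
open import Relation.Binary.PropositionalEquality using (_≡_; refl; subst; cong)
open import Axiom.UniquenessOfIdentityProofs.WithK using (uip)

open Equivalence

preimage : ∀ {A B} (H : PCont A B) (V : Subset (Carrier B)) → Open B V →
           Subset (Carrier A)
preimage H V oV = proj₁ (cont H V oV)

preimage-open : ∀ {A B} (H : PCont A B) V (oV : Open B V) →
                Open A (preimage H V oV)
preimage-open H V oV = proj₁ (proj₂ (cont H V oV))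

preimage-spec : ∀ {A B} (H : PCont A B) V (oV : Open B V) x (d : dom H x) →
                V (app H x d) ⇔ preimage H V oV x
preimage-spec H V oV = proj₂ (proj₂ (cont H V oV))

_∘ᵖ_ : ∀ {A B C} → PCont B C → PCont A B → PCont A C
_∘ᵖ_ {A} K H = record
  { dom      = λ x → Σ (dom H x) λ d → dom K (app H x d)
  ; dom-prop = dom-prop-∘
  ; app      = λ x de → app K (app H x (proj₁ de)) (proj₂ de)
  ; cont     = λ V oV →
      let U = preimage K V oV ; oU = preimage-open K V oV in
      preimage H U oU , preimage-open H U oU ,
      λ x (d , e) → ⇔-trans (preimage-spec K V oV _ e) (preimage-spec H U oU x d)
  }
  where
  dom-prop-∘ : (x : Carrier A) (p q : Σ (dom H x) λ d → dom K (app H x d)) → p ≡ q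
  dom-prop-∘ x (d , e) (d′ , e′) with dom-prop H x d d′
  ... | refl = cong (d ,_) (dom-prop K _ e e′)

total : ∀ {A B} (h : Carrier A → Carrier B) →
        (∀ V → Open B V → Open A (λ x → V (h x))) → PCont A B
total h h-cont = record
  { dom      = λ _ → ⊤
  ; dom-prop = λ { _ tt tt → refl }
  ; app      = λ x _ → h x
  ; cont     = λ V oV → (λ x → V (h x)) , h-cont V oV , λ _ _ → ⇔-refl
  }

snd : ∀ {A B} → PCont (A ⊗ B) B
snd {A} {B} = total proj₂ λ V oV →
  basic ((λ _ → ⊤) , V , full-open A , oV ,
         λ _ → mk⇔ (λ v → tt , v) proj₂)

module Coproduct {I : Set} (X : I → Space) where

  Car : I → Set
  Car i = Carrier (X i)

  summand : (i : I) → Subset (Car i) → Subset (Σ I Car)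
  summand i U (k , x) = Σ (k ≡ i) λ p → U (subst Car p x)

  summand-open : ∀ i U → Open (X i) U → Open (∐ I X) (summand i U)
  summand-open i U oU =
    basic (i , U , oU , (λ x → mk⇔ (λ { (refl , u) → u }) (λ u → refl , u)) ,
           λ { j x (p , _) → p })

  -- By induction on the generation of W; a generator {k} × U has slice U
  -- when i ≡ k and the empty slice otherwise, written as a union over i ≡ k.
  slice-open : ∀ i {W} → Open (∐ I X) W → Open (X i) (λ x → W (i , x))
  slice-open i {W} (basic (k , U , oU , W⇔U , W⊆k)) =
    ext-open (X i)
      (⋃-open (X i) (i ≡ k) (λ _ x → W (i , x))
        (λ { refl → ext-open (X i) oU (λ x → ⇔-sym (W⇔U x)) }))
      (λ x → mk⇔ proj₂ (λ w → W⊆k i x w , w))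
  slice-open i full          = full-open (X i)
  slice-open i (inter oU oV) = ∩-open (X i) (slice-open i oU) (slice-open i oV)
  slice-open i (union J U oU) = ⋃-open (X i) J _ (λ j → slice-open i (oU j))
  slice-open i (ext oU U⇔V)  = ext-open (X i) (slice-open i oU) (λ x → U⇔V (i , x))

  ι : (i : I) → PCont (X i) (∐ I X)
  ι i = total (i ,_) (λ V oV → slice-open i oV)

  π : (j : I) → PCont (∐ I X) (X j)
  π j = record
    { dom      = λ p → proj₁ p ≡ j
    ; dom-prop = λ _ → uip
    ; app      = λ { (_ , y) refl → y }
    ; cont     = λ V oV → summand j V , summand-open j V oV ,
        λ { (_ , y) refl → mk⇔ (λ v → refl , v) (λ { (refl , v) → v }) }
    }

  -- Copairing: a family of continuous partial maps on the summands glues to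
  -- one on the coproduct; the preimage is the union of the summands of the
  -- preimages.
  [_] : ∀ {B} → ((i : I) → PCont (X i) B) → PCont (∐ I X) B
  [ H ] = record
    { dom      = λ { (i , x) → dom (H i) x }
    ; dom-prop = λ { (i , x) → dom-prop (H i) x }
    ; app      = λ { (i , x) d → app (H i) x d }
    ; cont     = λ V oV →
        (λ p → Σ I λ i → summand i (preimage (H i) V oV) p) ,
        union I _ (λ i → summand-open i _ (preimage-open (H i) V oV)) ,
        λ { (i , x) d → mk⇔
              (λ v → i , refl , to (preimage-spec (H i) V oV x d) v)
              (λ { (_ , refl , u) → from (preimage-spec (H i) V oV x d) u }) }
    }

  module WithFactor (C : Space) where

    summand⊗ : (i : I) → Subset (Car i × Carrier C) → Subset (Σ I Car × Carrier C)
    summand⊗ i U ((k , x) , z) = Σ (k ≡ i) λ p → U (subst Car p x , z)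

    -- It is open when U is open in X i ⊗ C: a rectangle A × B goes to the
    -- rectangle ({i} × A) × B, and the set operations commute with summand⊗.
    summand⊗-open : ∀ i {U} → Open (X i ⊗ C) U → Open (∐ I X ⊗ C) (summand⊗ i U)
    summand⊗-open i (basic (A , B , oA , oB , U⇔A×B)) =
      basic (summand i A , B , summand-open i A oA , oB ,
        λ { ((k , x) , z) → mk⇔
              (λ { (refl , u) → (refl , proj₁ (to (U⇔A×B (x , z)) u)) , proj₂ (to (U⇔A×B (x , z)) u) })
              (λ { ((refl , a) , b) → refl , from (U⇔A×B (x , z)) (a , b) }) })
    summand⊗-open i full =
      basic (summand i (λ _ → ⊤) , (λ _ → ⊤) , summand-open i _ (full-open (X i)) , full-open C ,
        λ { ((k , x) , z) → mk⇔ (λ { (refl , t) → (refl , t) , t })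
                                (λ { ((refl , t) , _) → refl , t }) })
    summand⊗-open i (inter oU oV) =
      ext (inter (summand⊗-open i oU) (summand⊗-open i oV))
        (λ { ((k , x) , z) → mk⇔ (λ { ((refl , u) , (refl , v)) → refl , (u , v) })
                                 (λ { (refl , (u , v)) → (refl , u) , (refl , v) }) })
    summand⊗-open i (union J U oU) =
      ext (union J _ (λ j → summand⊗-open i (oU j)))
        (λ { ((k , x) , z) → mk⇔ (λ { (j , refl , u) → refl , j , u })
                                 (λ { (refl , j , u) → j , refl , u }) })
    summand⊗-open i (ext oU U⇔V) =
      ext (summand⊗-open i oU)
        (λ { ((k , x) , z) → mk⇔ (λ { (refl , u) → refl , to (U⇔V (x , z)) u })
                                 (λ { (refl , u) → refl , from (U⇔V (x , z)) u }) })

-- Products distribute over coproducts: ((i , x) , z) ↦ (i , (x , z)) is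
-- continuous, since the preimage of W is the union over i of the summands
-- of the (open) slices of W.
distrib : ∀ {I} (X : I → Space) (C : Space) → PCont (∐ I X ⊗ C) (∐ I (λ i → X i ⊗ C))
distrib {I} X C = total (λ { ((i , x) , z) → i , (x , z) }) λ W oW →
  ext (union I _ (λ i → summand⊗-open i (slice-open i oW)))
    (λ { ((i , x) , z) → mk⇔ (λ { (_ , refl , w) → w }) (λ w → i , refl , w) })
  where
  open Coproduct X using (module WithFactor)
  open WithFactor C using (summand⊗-open)
  open Coproduct (λ i → X i ⊗ C) using (slice-open)

module _ (I : Set) (f : I → Fun) where
  open module D = Coproduct (λ i → Dom (f i)) using ([_])
  open module Y = Coproduct (λ i → Cod (f i)) using (ι; π)

  upper-bound : (j : I) → f j ≤₂ ⌈ f ⌉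
  upper-bound j = π j ∘ᵖ snd {Dom (f j)} , D.ι j , λ x → tt , (tt , refl) , refl

  least : (g : Fun) → ((i : I) → f i ≤₂ g) → ⌈ f ⌉ ≤₂ g
  least g f≤g = F , G , reduces
    where
    F : PCont (Dom ⌈ f ⌉ ⊗ Cod g) (Cod ⌈ f ⌉)
    F = [ (λ i → ι i ∘ᵖ proj₁ (f≤g i)) ]ᶜ ∘ᵖ distrib (λ i → Dom (f i)) (Cod g)
      where open Coproduct (λ i → Dom (f i) ⊗ Cod g) using () renaming ([_] to [_]ᶜ)
    G : PCont (Dom ⌈ f ⌉) (Dom g)
    G = [ (λ i → proj₁ (proj₂ (f≤g i))) ]
    reduces : (x : Carrier (Dom ⌈ f ⌉)) →
      Σ[ dG ∈ dom G x ] Σ[ dF ∈ dom F (x , fn g (app G x dG)) ]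
        fn ⌈ f ⌉ x ≡ app F (x , fn g (app G x dG)) dF
    reduces (i , x) with proj₂ (proj₂ (f≤g i)) x
    ... | dG , dF , eq = dG , (tt , dF , tt) , cong (i ,_) eq

theorem4p4 : (I : Set) (f : I → Fun) →
    ((j : I) → f j ≤₂ ⌈ f ⌉)
    × ((g : Fun) → ((i : I) → f i ≤₂ g) → ⌈ f ⌉ ≤₂ g)
theorem4p4 I f = upper-bound I f , least I f
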